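{- Let $h$ be the morphism on $\{0,1,2\}^*$ defined by $h(0)=01$, $h(1)=21$, $h(2)=0$, and let $\mathbf{p}=012102101021012101021012\cdots$ be the infinite fixed point of $h$ beginning with $0$. Then for every integer $n\geq 0$, the number of distinct factors of $\mathbf{p}$ of length $n$ is exactly $2n+1$.
   Context: A factor of an infinite word is a finite contiguous block of it. The factor complexity $\rho_{\mathbf{p}}(n)$ is the number of distinct factors of $\mathbf{p}$ of length $n$. -}

module Defs where

open import Data.Nat using (ℕ; zero; suc; _+_; _*_)
open import Data.Fin using (Fin; zero; suc)
open import Data.List using (List; []; _∷_; concatMap; length)
open import Data.Vec using (Vec; lookup)
open import Data.Product using (Σ; ∃; _×_)
open import Data.List.Relation.Unary.Unique.Propositional using (Unique)
open import Data.List.Membership.Propositional using (_∈_)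
open import Relation.Binary.PropositionalEquality using (_≡_)
open import Function.Bundles using (_⇔_)

Letter : Set
Letter = Fin 3

h : Letter → List Letter
h zero = zero ∷ suc zero ∷ []
h (suc zero) = suc (suc zero) ∷ suc zero ∷ []
h (suc (suc zero)) = zero ∷ []

hWord : List Letter → List Letter
hWord = concatMap h

hIter : ℕ → List Letter
hIter zero = zero ∷ []
hIter (suc k) = hWord (hIter k)

nth : List Letter → ℕ → Letter
nth [] i = zero
nth (x ∷ xs) zero = x
nth (x ∷ xs) (suc i) = nth xs i

-- the fixed point p of h starting with 0 (p = lim h^k(0)).
-- Each h^k(0) is a prefix of h^(k+1)(0) and |h^(i+1)(0)| > i,
-- so p i is the i-th letter of h^(i+1)(0) (never uses the default).
p : ℕ → Letter
p i = nth (hIter (suc i)) i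

IsFactor : {n : ℕ} → Vec Letter n → Set
IsFactor {n} w = ∃ λ i → (j : Fin n) → lookup w j ≡ p (i + Data.Fin.toℕ j)

ComplexityIs : ℕ → ℕ → Set
ComplexityIs n m =
  Σ (List (Vec Letter n)) λ L →
    Unique L × length L ≡ m × ((w : Vec Letter n) → (w ∈ L) ⇔ IsFactor w)

-- A factor w is right special if at least two of w0, w1, w2 are factors. The only two-letter
-- factors are 01, 02, 10, 12, 21, so a right special factor has exactly two extensions, never ends
-- in 2, and ρ(n + 1) − ρ(n) is the number of right special factors of length n. For every n ≥ 1
-- there is exactly one ending in 0 and one ending in 1, so ρ(n + 1) = ρ(n) + 2 from ρ(1) = 3.
-- Existence: applying h maps a right special factor ending in 0 to one ending in 1 of at least the
-- same length, and one ending in 1 (followed by 0) to a longer one ending in 0. Uniqueness, by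
-- strong induction on the length: cutting p = h(p) into the blocks h(p k), a right special factor
-- ending in 0 (without its last letter) or in 1 is, up to its first letter, a suffix of the image
-- of a shorter right special factor whose last letter is determined, and equal preimages have
-- equal images.
module Submission where

open import Defs
open import Data.Empty using (⊥-elim)
open import Data.Fin using (zero; suc; toℕ; fromℕ<)
open import Data.Fin.Properties using (toℕ<n; toℕ-fromℕ<) renaming (_≟_ to _≟ᶠ_)
open import Data.List using (List; []; _∷_; _++_; length; map)
open import Data.List.Properties using (++-assoc; length-++; length-map; concatMap-++)
open import Data.List.Membership.Propositional using (_∈_)
open import Data.List.Membership.Propositional.Properties using (∈-map⁺; ∈-map⁻)
open import Data.List.Relation.Unary.All as All using (All; []; _∷_)
open import Data.List.Relation.Unary.AllPairs as AllPairs using (AllPairs; []; _∷_)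
open import Data.List.Relation.Unary.AllPairs.Properties as AllPairs using ()
open import Data.List.Relation.Unary.Any using (here; there)
open import Data.Nat using (ℕ; zero; suc; _+_; _*_; _≤_; _<_; _<?_; z≤n; s≤s; pred)
open import Data.Nat.Induction using (<-rec)
open import Data.Nat.Properties
open import Data.Product using (∃; _×_; _,_; proj₁; proj₂)
open import Data.Sum using (_⊎_; inj₁; inj₂; map₂)
open import Data.Vec using (Vec; lookup; tabulate)
open import Data.Vec.Properties using (lookup∘tabulate; tabulate∘lookup; tabulate-cong)
open import Function using (case_of_; _∘_)
open import Function.Bundles using (_⇔_; mk⇔; Equivalence)
open import Relation.Binary.PropositionalEquality
open import Relation.Nullary using (¬_; yes; no)

pattern L0 = zero
pattern L1 = suc zero
pattern L2 = suc (suc zero)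

blockLength : Letter → ℕ
blockLength c = length (h c)

firstLetter : Letter → Letter
firstLetter c = nth (h c) 0

lastLetter : Letter → Letter
lastLetter c = nth (h c) (pred (blockLength c))

0<blockLength : ∀ c → 0 < blockLength c
0<blockLength L0 = s≤s z≤n
0<blockLength L1 = s≤s z≤n
0<blockLength L2 = s≤s z≤n

blockLength≡2 : ∀ c → c ≢ L2 → blockLength c ≡ 2
blockLength≡2 L0 _ = refl
blockLength≡2 L1 _ = refl
blockLength≡2 L2 c≢2 = ⊥-elim (c≢2 refl)

suc-pred-blockLength : ∀ c → suc (pred (blockLength c)) ≡ blockLength c
suc-pred-blockLength L0 = refl
suc-pred-blockLength L1 = refl
suc-pred-blockLength L2 = refl

second-letter : ∀ c → c ≢ L2 → 1 < blockLength c × nth (h c) 1 ≡ L1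
second-letter L0 _ = s≤s (s≤s z≤n) , refl
second-letter L1 _ = s≤s (s≤s z≤n) , refl
second-letter L2 c≢2 = ⊥-elim (c≢2 refl)

lastLetter≢2 : ∀ {c} → c ≢ L2 → lastLetter c ≡ L1
lastLetter≢2 {L0} _ = refl
lastLetter≢2 {L1} _ = refl
lastLetter≢2 {L2} c≢2 = ⊥-elim (c≢2 refl)

firstLetter-injective : ∀ {c d} → c ≢ L2 → d ≢ L2 → firstLetter c ≡ firstLetter d → c ≡ d
firstLetter-injective {L0} {L0} _ _ _ = refl
firstLetter-injective {L1} {L1} _ _ _ = refl
firstLetter-injective {L2} c≢2 _ _ = ⊥-elim (c≢2 refl)
firstLetter-injective {_} {L2} _ d≢2 _ = ⊥-elim (d≢2 refl)
firstLetter-injective {L0} {L1} _ _ ()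
firstLetter-injective {L1} {L0} _ _ ()

lastLetter-collision : ∀ {c d} → c ≢ d → lastLetter c ≡ lastLetter d → c ≢ L2 × d ≢ L2
lastLetter-collision {L0} {L1} _ _ = (λ ()) , (λ ())
lastLetter-collision {L1} {L0} _ _ = (λ ()) , (λ ())
lastLetter-collision {L0} {L0} c≢d _ = ⊥-elim (c≢d refl)
lastLetter-collision {L1} {L1} c≢d _ = ⊥-elim (c≢d refl)
lastLetter-collision {L2} {L2} c≢d _ = ⊥-elim (c≢d refl)
lastLetter-collision {L0} {L2} _ ()
lastLetter-collision {L1} {L2} _ ()
lastLetter-collision {L2} {L0} _ ()
lastLetter-collision {L2} {L1} _ ()

one-of-them-is-1 : ∀ {c d : Letter} → c ≢ d → c ≢ L2 → d ≢ L2 → c ≡ L1 ⊎ d ≡ L1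
one-of-them-is-1 {L1} _ _ _ = inj₁ refl
one-of-them-is-1 {_} {L1} _ _ _ = inj₂ refl
one-of-them-is-1 {L0} {L0} c≢d _ _ = ⊥-elim (c≢d refl)
one-of-them-is-1 {L2} _ c≢2 _ = ⊥-elim (c≢2 refl)
one-of-them-is-1 {_} {L2} _ _ d≢2 = ⊥-elim (d≢2 refl)

-- The two-letter factors of p (p-⟶ shows that no others occur).
data _⟶_ : Letter → Letter → Set where
  0⟶1 : L0 ⟶ L1
  0⟶2 : L0 ⟶ L2
  1⟶0 : L1 ⟶ L0
  1⟶2 : L1 ⟶ L2
  2⟶1 : L2 ⟶ L1

⟶-irrefl : ∀ {c d} → c ⟶ d → c ≢ d
⟶-irrefl 0⟶1 ()
⟶-irrefl 0⟶2 ()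
⟶-irrefl 1⟶0 ()
⟶-irrefl 1⟶2 ()
⟶-irrefl 2⟶1 ()

2⟶ : ∀ {d} → L2 ⟶ d → d ≡ L1
2⟶ 2⟶1 = refl

⟶-at-most-two : ∀ {c x y z} → c ⟶ x → c ⟶ y → c ⟶ z → x ≢ z → y ≢ z → x ≡ y
⟶-at-most-two 0⟶1 0⟶1 _ _ _ = refl
⟶-at-most-two 0⟶2 0⟶2 _ _ _ = refl
⟶-at-most-two 1⟶0 1⟶0 _ _ _ = refl
⟶-at-most-two 1⟶2 1⟶2 _ _ _ = refl
⟶-at-most-two 2⟶1 2⟶1 _ _ _ = refl
⟶-at-most-two 0⟶1 0⟶2 0⟶1 x≢z _ = ⊥-elim (x≢z refl)
⟶-at-most-two 0⟶1 0⟶2 0⟶2 _ y≢z = ⊥-elim (y≢z refl)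
⟶-at-most-two 0⟶2 0⟶1 0⟶1 _ y≢z = ⊥-elim (y≢z refl)
⟶-at-most-two 0⟶2 0⟶1 0⟶2 x≢z _ = ⊥-elim (x≢z refl)
⟶-at-most-two 1⟶0 1⟶2 1⟶0 x≢z _ = ⊥-elim (x≢z refl)
⟶-at-most-two 1⟶0 1⟶2 1⟶2 _ y≢z = ⊥-elim (y≢z refl)
⟶-at-most-two 1⟶2 1⟶0 1⟶0 _ y≢z = ⊥-elim (y≢z refl)
⟶-at-most-two 1⟶2 1⟶0 1⟶2 x≢z _ = ⊥-elim (x≢z refl)

⟶-branching-avoiding-1 : ∀ {x y z} → x ⟶ y → x ⟶ z → y ≢ z → y ≢ L1 → z ≢ L1 → x ≡ L1
⟶-branching-avoiding-1 1⟶0 _ _ _ _ = refl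
⟶-branching-avoiding-1 1⟶2 _ _ _ _ = refl
⟶-branching-avoiding-1 0⟶1 _ _ y≢1 _ = ⊥-elim (y≢1 refl)
⟶-branching-avoiding-1 0⟶2 0⟶1 _ _ z≢1 = ⊥-elim (z≢1 refl)
⟶-branching-avoiding-1 0⟶2 0⟶2 y≢z _ _ = ⊥-elim (y≢z refl)
⟶-branching-avoiding-1 2⟶1 _ _ y≢1 _ = ⊥-elim (y≢1 refl)

⟶-branching-with-first-letters : ∀ {x y z} → x ⟶ y → x ⟶ z → firstLetter y ≢ firstLetter z → x ≡ L0
⟶-branching-with-first-letters 0⟶1 _ _ = refl
⟶-branching-with-first-letters 0⟶2 _ _ = refl
⟶-branching-with-first-letters 1⟶0 1⟶0 ≢ = ⊥-elim (≢ refl)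
⟶-branching-with-first-letters 1⟶0 1⟶2 ≢ = ⊥-elim (≢ refl)
⟶-branching-with-first-letters 1⟶2 1⟶0 ≢ = ⊥-elim (≢ refl)
⟶-branching-with-first-letters 1⟶2 1⟶2 ≢ = ⊥-elim (≢ refl)
⟶-branching-with-first-letters 2⟶1 2⟶1 ≢ = ⊥-elim (≢ refl)

1⟶firstLetter : ∀ c → L1 ⟶ firstLetter c
1⟶firstLetter L0 = 1⟶0
1⟶firstLetter L1 = 1⟶2
1⟶firstLetter L2 = 1⟶0

firstLetter-injective-after-0 : ∀ {x y} → L0 ⟶ x → L0 ⟶ y → firstLetter x ≡ firstLetter y → x ≡ y
firstLetter-injective-after-0 0⟶1 0⟶1 _ = refl
firstLetter-injective-after-0 0⟶2 0⟶2 _ = refl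
firstLetter-injective-after-0 0⟶1 0⟶2 ()
firstLetter-injective-after-0 0⟶2 0⟶1 ()

firstLetter-after-1 : ∀ {x} → L1 ⟶ x → firstLetter x ≡ L0
firstLetter-after-1 1⟶0 = refl
firstLetter-after-1 1⟶2 = refl

hWord-++ : ∀ u v → hWord (u ++ v) ≡ hWord u ++ hWord v
hWord-++ = concatMap-++ h

Prefix : List Letter → List Letter → Set
Prefix u v = ∃ λ w → v ≡ u ++ w

hIter-head : ∀ d → Prefix (hIter 0) (hIter d)
hIter-head zero = [] , refl
hIter-head (suc d) with hIter-head d
... | w , eq = L1 ∷ hWord w , cong hWord eq

hWord-prefix : ∀ {u v} → Prefix u v → Prefix (hWord u) (hWord v)
hWord-prefix {u} (w , refl) = hWord w , hWord-++ u w

hIter-prefix : ∀ k d → Prefix (hIter k) (hIter (k + d))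
hIter-prefix zero d = hIter-head d
hIter-prefix (suc k) d = hWord-prefix (hIter-prefix k d)

nth-++ˡ : ∀ u v {i} → i < length u → nth (u ++ v) i ≡ nth u i
nth-++ˡ (x ∷ u) v {zero} _ = refl
nth-++ˡ (x ∷ u) v {suc i} (s≤s i<∣u∣) = nth-++ˡ u v i<∣u∣

nth-++ʳ : ∀ u v i → nth (u ++ v) (length u + i) ≡ nth v i
nth-++ʳ [] v i = refl
nth-++ʳ (x ∷ u) v i = nth-++ʳ u v i

∣u∣≤∣hWord-u∣ : ∀ u → length u ≤ length (hWord u)
∣u∣≤∣hWord-u∣ [] = z≤n
∣u∣≤∣hWord-u∣ (c ∷ u) = subst (suc (length u) ≤_) (sym (length-++ (h c)))
  (+-mono-≤ (0<blockLength c) (∣u∣≤∣hWord-u∣ u))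

k<∣hIter-k∣ : ∀ k → k < length (hIter k)
k<∣hIter-k∣ zero = s≤s z≤n
k<∣hIter-k∣ (suc k) with hIter-head k | k<∣hIter-k∣ k
... | w , eq | k<∣hIter∣ rewrite eq = s≤s (s≤s (≤-trans (≤-pred k<∣hIter∣) (∣u∣≤∣hWord-u∣ w)))

nth-hIter-mono : ∀ {k k′ i} → k ≤ k′ → i < length (hIter k) → nth (hIter k′) i ≡ nth (hIter k) i
nth-hIter-mono {k} {i = i} k≤k′ i<∣hIter-k∣ with m≤n⇒∃[o]m+o≡n k≤k′
... | d , refl with hIter-prefix k d
... | w , eq = trans (cong (λ u → nth u i) eq) (nth-++ˡ (hIter k) w i<∣hIter-k∣)

p≡nth-hIter : ∀ {i} k → i < length (hIter k) → p i ≡ nth (hIter k) i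
p≡nth-hIter {i} k i<∣hIter-k∣ with ≤-total k (suc i)
... | inj₁ k≤1+i = nth-hIter-mono k≤1+i i<∣hIter-k∣
... | inj₂ 1+i≤k = sym (nth-hIter-mono 1+i≤k (<-trans (n<1+n i) (k<∣hIter-k∣ (suc i))))

-- start k is the position in p = h(p) where the block h(p k) begins.
start : ℕ → ℕ
start zero = 0
start (suc k) = start k + blockLength (p k)

offset : List Letter → ℕ → ℕ
offset [] k = 0
offset (c ∷ w) zero = 0
offset (c ∷ w) (suc k) = blockLength c + offset w k

offset-zero : ∀ w → offset w 0 ≡ 0
offset-zero [] = refl
offset-zero (c ∷ w) = refl

offset-suc : ∀ w {k} → k < length w → offset w (suc k) ≡ offset w k + blockLength (nth w k)
offset-suc (c ∷ w) {zero} _ = trans (cong (blockLength c +_) (offset-zero w)) (+-identityʳ (blockLength c))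
offset-suc (c ∷ w) {suc k} (s≤s k<∣w∣) =
  trans (cong (blockLength c +_) (offset-suc w k<∣w∣)) (sym (+-assoc (blockLength c) _ _))

offset≡start : ∀ w k → k ≤ length w → (∀ {j} → j < k → nth w j ≡ p j) → offset w k ≡ start k
offset≡start w zero _ _ = offset-zero w
offset≡start w (suc k) k<∣w∣ w≡p = trans (offset-suc w k<∣w∣)
  (cong₂ _+_ (offset≡start w k (<⇒≤ k<∣w∣) (λ j<k → w≡p (m<n⇒m<1+n j<k)))
             (cong blockLength (w≡p (n<1+n k))))

offset+r<∣hWord∣ : ∀ w {k r} → k < length w → r < blockLength (nth w k) → offset w k + r < length (hWord w)
offset+r<∣hWord∣ (c ∷ w) {zero} _ r<∣hc∣ = subst (_ <_) (sym (length-++ (h c))) (≤-trans r<∣hc∣ (m≤m+n _ _))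
offset+r<∣hWord∣ (c ∷ w) {suc k} {r} (s≤s k<∣w∣) r<∣h∣ =
  subst₂ _<_ (sym (+-assoc (blockLength c) (offset w k) r)) (sym (length-++ (h c)))
    (+-monoʳ-< (blockLength c) (offset+r<∣hWord∣ w k<∣w∣ r<∣h∣))

nth-hWord-offset : ∀ w {k r} → k < length w → r < blockLength (nth w k) →
  nth (hWord w) (offset w k + r) ≡ nth (h (nth w k)) r
nth-hWord-offset (c ∷ w) {zero} _ r<∣hc∣ = nth-++ˡ (h c) (hWord w) r<∣hc∣
nth-hWord-offset (c ∷ w) {suc k} {r} (s≤s k<∣w∣) r<∣h∣ =
  trans (cong (nth (h c ++ hWord w)) (+-assoc (blockLength c) (offset w k) r))
        (trans (nth-++ʳ (h c) (hWord w) (offset w k + r)) (nth-hWord-offset w k<∣w∣ r<∣h∣))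

p-block : ∀ k {r} → r < blockLength (p k) → p (start k + r) ≡ nth (h (p k)) r
p-block k {r} r<∣h∣ = begin
  p (start k + r)                   ≡⟨ p≡nth-hIter (suc (suc k)) in-range ⟩
  nth (hWord w) (start k + r)       ≡⟨ cong (λ o → nth (hWord w) (o + r)) (sym offset≡) ⟩
  nth (hWord w) (offset w k + r)    ≡⟨ nth-hWord-offset w k<∣w∣ r<∣h∣′ ⟩
  nth (h (nth w k)) r               ≡⟨ cong (λ c → nth (h c) r) w-k≡p-k ⟩
  nth (h (p k)) r                   ∎
  where
    open ≡-Reasoning
    w = hIter (suc k)
    k<∣w∣ : k < length w
    k<∣w∣ = <-trans (n<1+n k) (k<∣hIter-k∣ (suc k))
    w-k≡p-k : nth w k ≡ p k
    w-k≡p-k = sym (p≡nth-hIter (suc k) k<∣w∣)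
    offset≡ : offset w k ≡ start k
    offset≡ = offset≡start w k (<⇒≤ k<∣w∣) (λ j<k → sym (p≡nth-hIter (suc k) (<-trans j<k k<∣w∣)))
    r<∣h∣′ : r < blockLength (nth w k)
    r<∣h∣′ = subst (λ c → r < blockLength c) (sym w-k≡p-k) r<∣h∣
    in-range : start k + r < length (hWord w)
    in-range = subst (λ o → o + r < length (hWord w)) offset≡ (offset+r<∣hWord∣ w k<∣w∣ r<∣h∣′)

p-start : ∀ k → p (start k) ≡ firstLetter (p k)
p-start k = trans (cong p (sym (+-identityʳ (start k)))) (p-block k (0<blockLength (p k)))

p-start+1 : ∀ k → p k ≢ L2 → p (suc (start k)) ≡ L1
p-start+1 k p-k≢2 = trans (cong p (+-comm 1 (start k)))
  (trans (p-block k (proj₁ (second-letter (p k) p-k≢2))) (proj₂ (second-letter (p k) p-k≢2)))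

p-last : ∀ k {e} → start (suc k) ≡ suc e → p e ≡ lastLetter (p k)
p-last k {e} start≡ = trans (cong p (sym start+last≡e))
  (p-block k (≤-reflexive (suc-pred-blockLength (p k))))
  where
    start+last≡e : start k + pred (blockLength (p k)) ≡ e
    start+last≡e = suc-injective (begin
      suc (start k + pred (blockLength (p k))) ≡⟨ sym (+-suc (start k) _) ⟩
      start k + suc (pred (blockLength (p k))) ≡⟨ cong (start k +_) (suc-pred-blockLength (p k)) ⟩
      start (suc k)                            ≡⟨ start≡ ⟩
      suc e                                    ∎)
      where open ≡-Reasoning

start-zero≢suc : ∀ {i} → start 0 ≢ suc i
start-zero≢suc ()

start-suc-of-2 : ∀ k → p k ≡ L2 → start (suc k) ≡ suc (start k)
start-suc-of-2 k p-k≡2 = trans (cong (λ c → start k + blockLength c) p-k≡2) (+-comm (start k) 1)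

start-suc-of-≢2 : ∀ k → p k ≢ L2 → start (suc k) ≡ suc (suc (start k))
start-suc-of-≢2 k p-k≢2 = trans (cong (start k +_) (blockLength≡2 (p k) p-k≢2)) (+-comm (start k) 2)

start-pred : ∀ {α i} → p α ≢ L2 → start (suc α) ≡ suc (suc i) → start α ≡ i
start-pred {α} p-α≢2 start≡ = suc-injective (suc-injective (trans (sym (start-suc-of-≢2 α p-α≢2)) start≡))

data InBlock (e : ℕ) : Set where
  first  : ∀ k → e ≡ start k → InBlock e
  second : ∀ k → p k ≢ L2 → e ≡ suc (start k) → InBlock e

inBlock : ∀ e → InBlock e
inBlock zero = first 0 refl
inBlock (suc e) with inBlock e
... | second k p-k≢2 refl = first (suc k) (sym (start-suc-of-≢2 k p-k≢2))
... | first k refl with p k ≟ᶠ L2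
...   | yes p-k≡2 = first (suc k) (sym (start-suc-of-2 k p-k≡2))
...   | no p-k≢2 = second k p-k≢2 refl

starts-block : ∀ e → p e ≢ L1 → ∃ λ k → e ≡ start k
starts-block e p-e≢1 with inBlock e
... | first k e≡ = k , e≡
... | second k p-k≢2 refl = ⊥-elim (p-e≢1 (p-start+1 k p-k≢2))

k<start-k : ∀ k → 0 < k → k < start k
k<start-k (suc zero) _ = s≤s (s≤s z≤n)
k<start-k (suc (suc k)) _ =
  ≤-trans (s≤s (k<start-k (suc k) (s≤s z≤n))) (m<m+n (start (suc k)) (0<blockLength (p (suc k))))

p≡2⇒0< : ∀ {k} → p k ≡ L2 → 0 < k
p≡2⇒0< {zero} ()
p≡2⇒0< {suc k} _ = s≤s z≤n

p-⟶ : ∀ e → p e ⟶ p (suc e)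
p-⟶ = <-rec (λ e → p e ⟶ p (suc e)) step
  where
    along : ∀ {a b c d} → a ≡ c → b ≡ d → c ⟶ d → a ⟶ b
    along refl refl c⟶d = c⟶d
    step : ∀ e → (∀ {e′} → e′ < e → p e′ ⟶ p (suc e′)) → p e ⟶ p (suc e)
    step e ⟶-below with inBlock e
    ... | second k p-k≢2 refl = along (p-start+1 k p-k≢2)
      (trans (cong p (sym (start-suc-of-≢2 k p-k≢2))) (p-start (suc k))) (1⟶firstLetter (p (suc k)))
    ... | first k refl with p k in p-k≡
    ...   | L0 = along (trans (p-start k) (cong firstLetter p-k≡)) (p-start+1 k (subst (_≢ L2) (sym p-k≡) (λ ()))) 0⟶1
    ...   | L1 = along (trans (p-start k) (cong firstLetter p-k≡)) (p-start+1 k (subst (_≢ L2) (sym p-k≡) (λ ()))) 2⟶1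
    ...   | L2 = along (trans (p-start k) (cong firstLetter p-k≡))
      (trans (cong p (sym (start-suc-of-2 k p-k≡))) (trans (p-start (suc k)) (cong firstLetter p-suc-k≡1))) 0⟶2
      where
        p-suc-k≡1 : p (suc k) ≡ L1
        p-suc-k≡1 = 2⟶ (subst (_⟶ p (suc k)) p-k≡ (⟶-below (k<start-k k (p≡2⇒0< p-k≡))))

p-no-square : ∀ e → p e ≢ p (suc e)
p-no-square e = ⟶-irrefl (p-⟶ e)

p-after-2 : ∀ e → p e ≡ L2 → p (suc e) ≡ L1
p-after-2 e p-e≡2 = 2⟶ (subst (_⟶ p (suc e)) p-e≡2 (p-⟶ e))

p-⟶-at : ∀ x n {c} → p (x + n) ≡ c → c ⟶ p (x + suc n)
p-⟶-at x n p≡c = subst₂ _⟶_ p≡c (cong p (sym (+-suc x n))) (p-⟶ (x + n))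

p-start+1-of-2 : ∀ k → p k ≡ L2 → p (suc (start k)) ≡ L2
p-start+1-of-2 k p-k≡2 = trans (cong p (sym (start-suc-of-2 k p-k≡2)))
  (trans (p-start (suc k)) (cong firstLetter (p-after-2 k p-k≡2)))

p-start≡0⇒p≢1 : ∀ k → p (start k) ≡ L0 → p k ≢ L1
p-start≡0⇒p≢1 k p-start≡0 p-k≡1 = case trans (sym p-start≡0) (trans (p-start k) (cong firstLetter p-k≡1)) of λ ()

p-before-start : ∀ {x e} → start x ≡ suc e → p x ≢ L1 → p e ≡ L1
p-before-start {zero} start≡ _ = ⊥-elim (start-zero≢suc start≡)
p-before-start {suc γ} start≡ p-x≢1 =
  trans (p-last γ start≡) (lastLetter≢2 (λ p-γ≡2 → p-x≢1 (p-after-2 γ p-γ≡2)))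

ZeroBlock : ℕ → Set
ZeroBlock k = (p k ≡ L0 × p (suc (start k)) ≡ L1) ⊎ (p k ≡ L2 × p (suc (start k)) ≡ L2)

zeroBlock : ∀ k → p (start k) ≡ L0 → ZeroBlock k
zeroBlock k p-start≡0 with p k in p-k≡
... | L0 = inj₁ (refl , p-start+1 k (subst (_≢ L2) (sym p-k≡) λ ()))
... | L1 = ⊥-elim (p-start≡0⇒p≢1 k p-start≡0 p-k≡)
... | L2 = inj₂ (refl , p-start+1-of-2 k p-k≡)

-- Below a block starting with 0, the next letter tells h(0) = 01 and h(2) = 0 apart.
after-0-block-start : ∀ {k l} → p (start k) ≡ L0 → p (start l) ≡ L0 →
  p k ≡ p l ⇔ p (suc (start k)) ≡ p (suc (start l))
after-0-block-start {k} {l} p-start-k≡0 p-start-l≡0 = compare (zeroBlock k p-start-k≡0) (zeroBlock l p-start-l≡0)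
  where
    compare : ZeroBlock k → ZeroBlock l → p k ≡ p l ⇔ p (suc (start k)) ≡ p (suc (start l))
    compare (inj₁ (k≡ , k′≡)) (inj₁ (l≡ , l′≡)) = mk⇔ (λ _ → trans k′≡ (sym l′≡)) (λ _ → trans k≡ (sym l≡))
    compare (inj₂ (k≡ , k′≡)) (inj₂ (l≡ , l′≡)) = mk⇔ (λ _ → trans k′≡ (sym l′≡)) (λ _ → trans k≡ (sym l≡))
    compare (inj₁ (k≡ , k′≡)) (inj₂ (l≡ , l′≡)) =
      mk⇔ (λ eq → case trans (sym k≡) (trans eq l≡) of λ ()) (λ eq → case trans (sym k′≡) (trans eq l′≡) of λ ())
    compare (inj₂ (k≡ , k′≡)) (inj₁ (l≡ , l′≡)) =
      mk⇔ (λ eq → case trans (sym k≡) (trans eq l≡) of λ ()) (λ eq → case trans (sym k′≡) (trans eq l′≡) of λ ())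

record Agree (i j n : ℕ) : Set where
  constructor mkAgree
  field at : ∀ t → t < n → p (i + t) ≡ p (j + t)
open Agree public

agree-[] : ∀ {i j} → Agree i j 0
agree-[] = mkAgree λ _ ()

agree-head : ∀ {i j n} → Agree i j (suc n) → p i ≡ p j
agree-head {i} {j} (mkAgree eq) =
  trans (cong p (sym (+-identityʳ i))) (trans (eq 0 (s≤s z≤n)) (cong p (+-identityʳ j)))

agree-tail : ∀ {i j n} → Agree i j (suc n) → Agree (suc i) (suc j) n
agree-tail {i} {j} (mkAgree eq) = mkAgree λ t t<n →
  trans (cong p (sym (+-suc i t))) (trans (eq (suc t) (s≤s t<n)) (cong p (+-suc j t)))

agree-∷ : ∀ {i j n} → p i ≡ p j → Agree (suc i) (suc j) n → Agree i j (suc n)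
agree-∷ {i} {j} p-i≡p-j (mkAgree eq) = mkAgree λ where
  zero _ → trans (cong p (+-identityʳ i)) (trans p-i≡p-j (cong p (sym (+-identityʳ j))))
  (suc t) (s≤s t<n) → trans (cong p (+-suc i t)) (trans (eq t t<n) (cong p (sym (+-suc j t))))

agree-≤ : ∀ {i j m n} → m ≤ n → Agree i j n → Agree i j m
agree-≤ m≤n (mkAgree eq) = mkAgree λ t t<m → eq t (≤-trans t<m m≤n)

agree-sym : ∀ {i j n} → Agree i j n → Agree j i n
agree-sym (mkAgree eq) = mkAgree λ t t<n → sym (eq t t<n)

agree-trans : ∀ {i j k n} → Agree i j n → Agree j k n → Agree i k n
agree-trans (mkAgree eq) (mkAgree eq′) = mkAgree λ t t<n → trans (eq t t<n) (eq′ t t<n)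

agree-last : ∀ {i j n} → Agree i j (suc n) → p (i + n) ≡ p (j + n)
agree-last {n = n} ag = at ag n ≤-refl

agree-∷ʳ : ∀ {i j n} → Agree i j n → p (i + n) ≡ p (j + n) → Agree i j (suc n)
agree-∷ʳ {i} {j} {n} (mkAgree eq) last≡ = mkAgree λ t t≤n → case m≤n⇒m<n∨m≡n (≤-pred t≤n) of λ where
  (inj₁ t<n) → eq t t<n
  (inj₂ refl) → last≡

agree-drop : ∀ {i j} d n → Agree i j (d + n) → Agree (i + d) (j + d) n
agree-drop {i} {j} d n (mkAgree eq) = mkAgree λ t t<n →
  trans (cong p (+-assoc i d t)) (trans (eq (d + t) (+-monoʳ-< d t<n)) (cong p (sym (+-assoc j d t))))

agree-++ : ∀ {i j} m n → Agree i j m → Agree (i + m) (j + m) n → Agree i j (m + n)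
agree-++ {i} {j} m n (mkAgree eq) (mkAgree eq′) = mkAgree λ t t<m+n → case t <? m of λ where
  (yes t<m) → eq t t<m
  (no t≮m) → case m≤n⇒∃[o]m+o≡n (≮⇒≥ t≮m) of λ where
    (s , refl) → trans (cong p (sym (+-assoc i m s)))
                       (trans (eq′ s (+-cancelˡ-< m s n t<m+n)) (cong p (+-assoc j m s)))

imageLength : ℕ → ℕ → ℕ
imageLength a zero = 0
imageLength a (suc m) = blockLength (p a) + imageLength (suc a) m

start-+ : ∀ a m → start (a + m) ≡ start a + imageLength a m
start-+ a zero = trans (cong start (+-identityʳ a)) (sym (+-identityʳ (start a)))
start-+ a (suc m) = trans (cong start (+-suc a m))
  (trans (start-+ (suc a) m) (+-assoc (start a) (blockLength (p a)) (imageLength (suc a) m)))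

imageLength-cong : ∀ {a b} m → Agree a b m → imageLength a m ≡ imageLength b m
imageLength-cong zero _ = refl
imageLength-cong (suc m) ag = cong₂ _+_ (cong blockLength (agree-head ag)) (imageLength-cong m (agree-tail ag))

m≤imageLength : ∀ a m → m ≤ imageLength a m
m≤imageLength a zero = z≤n
m≤imageLength a (suc m) = +-mono-≤ (0<blockLength (p a)) (m≤imageLength (suc a) m)

imageLength-suc : ∀ a m → imageLength a (suc m) ≡ imageLength a m + blockLength (p (a + m))
imageLength-suc a zero = trans (+-identityʳ _) (cong (λ x → blockLength (p x)) (sym (+-identityʳ a)))
imageLength-suc a (suc m) = trans (cong (blockLength (p a) +_) (imageLength-suc (suc a) m))
  (trans (sym (+-assoc (blockLength (p a)) _ _))
         (cong (λ x → blockLength (p a) + imageLength (suc a) m + blockLength (p x)) (sym (+-suc a m))))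

2+m≤imageLength : ∀ a m → p (a + m) ≢ L2 → suc (suc m) ≤ imageLength a (suc m)
2+m≤imageLength a m p≢2 = subst (suc (suc m) ≤_) (sym (imageLength-suc a m))
  (subst (λ l → suc (suc m) ≤ imageLength a m + l) (sym (blockLength≡2 (p (a + m)) p≢2))
    (subst (_≤ imageLength a m + 2) (+-comm m 2) (+-monoˡ-≤ 2 (m≤imageLength a m))))

agree-block : ∀ {a b} → p a ≡ p b → Agree (start a) (start b) (blockLength (p a))
agree-block {a} {b} p-a≡p-b = mkAgree λ t t<∣h∣ → trans (p-block a t<∣h∣)
  (trans (cong (λ c → nth (h c) t) p-a≡p-b) (sym (p-block b (subst (λ c → t < blockLength c) p-a≡p-b t<∣h∣))))

agree-image : ∀ {a b} m → Agree a b m → Agree (start a) (start b) (imageLength a m)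
agree-image zero _ = agree-[]
agree-image {a} {b} (suc m) ag =
  agree-++ (blockLength (p a)) (imageLength (suc a) m) (agree-block {a} {b} (agree-head ag))
  (subst (λ l → Agree (start (suc a)) (start b + l) (imageLength (suc a) m)) (cong blockLength (sym (agree-head ag)))
    (agree-image m (agree-tail ag)))

image-ends : ∀ {a b} m → Agree a b m →
  start (a + m) ≡ start a + imageLength a m × start (b + m) ≡ start b + imageLength a m
image-ends {a} {b} m ag = start-+ a m , trans (start-+ b m) (cong (start b +_) (sym (imageLength-cong m ag)))

aligned : ∀ {i j t x y w} d → i + t ≡ x + w → j + t ≡ y + w → x ≡ d + i → y ≡ d + j
aligned {i} {j} {t} {x} {y} {w} d i+t≡x+w j+t≡y+w x≡d+i = +-cancelʳ-≡ w y (d + j) (begin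
  y + w           ≡⟨ sym j+t≡y+w ⟩
  j + t           ≡⟨ cong (j +_) t≡d+w ⟩
  j + (d + w)     ≡⟨ sym (+-assoc j d w) ⟩
  j + d + w       ≡⟨ cong (_+ w) (+-comm j d) ⟩
  d + j + w       ∎)
  where
    open ≡-Reasoning
    t≡d+w : t ≡ d + w
    t≡d+w = +-cancelˡ-≡ i t (d + w) (begin
      i + t       ≡⟨ i+t≡x+w ⟩
      x + w       ≡⟨ cong (_+ w) (trans x≡d+i (+-comm d i)) ⟩
      i + d + w   ≡⟨ +-assoc i d w ⟩
      i + (d + w) ∎)

agree-inner : ∀ {x y i i′ t w} → x ≤ i → i + t ≡ x + w → i′ + t ≡ y + w → Agree x y w → Agree i i′ t
agree-inner {x} {y} {i} {i′} {t} {w} x≤i i-end i′-end ag with m≤n⇒∃[o]m+o≡n x≤i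
... | e , refl = subst (λ z → Agree (x + e) z t) (sym i′≡y+e) (agree-drop e t (subst (Agree x y) (sym e+t≡w) ag))
  where
    e+t≡w : e + t ≡ w
    e+t≡w = +-cancelˡ-≡ x (e + t) w (trans (sym (+-assoc x e t)) i-end)
    i′≡y+e : i′ ≡ y + e
    i′≡y+e = +-cancelʳ-≡ t i′ (y + e) (trans i′-end (trans (cong (y +_) (sym e+t≡w)) (sym (+-assoc y e t))))

-- Desubstitution

-- Position i is the common last letter of two different two-letter blocks α and β, so the
-- preimage cannot be extended further to the left.
record Split (i a b : ℕ) : Set where
  constructor mkSplit
  field
    start-a≡ : start a ≡ suc i
    α β : ℕ
    a≡ : a ≡ suc α
    b≡ : b ≡ suc β
    p-α≢p-β : p α ≢ p β
    p-α≢2 : p α ≢ L2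
    p-β≢2 : p β ≢ L2

Anchored : ℕ → ℕ → ℕ → Set
Anchored i a m = start a ≤ i × (m ≡ 0 ⊎ i < start (suc a))

-- The windows p[i, i + t) = p[j, j + t) end where the blocks k and l begin; they are suffixes of
-- the images of p[a, k) = p[b, l), except that in the Split case these images miss position i.
record Desubstitution (t i j k l : ℕ) : Set where
  field
    a b m : ℕ
    a+m≡k : a + m ≡ k
    b+m≡l : b + m ≡ l
    m≤t : m ≤ t
    agree : Agree a b m
    left-end : Anchored i a m ⊎ Split i a b

split-unextendable : ∀ {i j a b} → Split (suc i) a b → start b ≡ suc (suc j) → p i ≢ p j
split-unextendable {i} {j} (mkSplit start-a≡ α β refl refl p-α≢p-β p-α≢2 p-β≢2) start-b≡ p-i≡p-j =
  p-α≢p-β (firstLetter-injective p-α≢2 p-β≢2 (begin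
    firstLetter (p α)  ≡⟨ sym (p-start α) ⟩
    p (start α)        ≡⟨ cong p (start-pred {α} p-α≢2 start-a≡) ⟩
    p i                ≡⟨ p-i≡p-j ⟩
    p j                ≡⟨ cong p (sym (start-pred {β} p-β≢2 start-b≡)) ⟩
    p (start β)        ≡⟨ p-start β ⟩
    firstLetter (p β)  ∎))
  where open ≡-Reasoning

desubstitute-at-cut : ∀ {t i j k l} a b m → a + m ≡ k → b + m ≡ l → m ≤ t → Agree a b m →
  start a ≡ suc i → start b ≡ suc j → p i ≡ p j → Desubstitution (suc t) i j k l
desubstitute-at-cut zero _ _ _ _ _ _ start-a≡ _ _ = ⊥-elim (start-zero≢suc start-a≡)
desubstitute-at-cut (suc _) zero _ _ _ _ _ _ start-b≡ _ = ⊥-elim (start-zero≢suc start-b≡)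
desubstitute-at-cut {i = i} (suc α) (suc β) m a+m≡k b+m≡l m≤t ag start-a≡ start-b≡ p-i≡p-j with p α ≟ᶠ p β
... | yes p-α≡p-β = record
  { a = α ; b = β ; m = suc m
  ; a+m≡k = trans (+-suc α m) a+m≡k ; b+m≡l = trans (+-suc β m) b+m≡l ; m≤t = s≤s m≤t
  ; agree = agree-∷ p-α≡p-β ag
  ; left-end = inj₁ (≤-pred (subst (start α <_) start-a≡ (m<m+n (start α) (0<blockLength (p α))))
                    , inj₂ (subst (i <_) (sym start-a≡) (n<1+n i))) }
... | no p-α≢p-β = record
  { a = suc α ; b = suc β ; m = m
  ; a+m≡k = a+m≡k ; b+m≡l = b+m≡l ; m≤t = m≤n⇒m≤1+n m≤t ; agree = ag
  ; left-end = inj₂ (mkSplit start-a≡ α β refl refl p-α≢p-β (proj₁ collision) (proj₂ collision)) }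
  where
    collision = lastLetter-collision p-α≢p-β (trans (sym (p-last α start-a≡)) (trans p-i≡p-j (p-last β start-b≡)))

desubstitute : ∀ t {i j k l} → i + t ≡ start k → j + t ≡ start l → Agree i j t → Desubstitution t i j k l
desubstitute zero {i} {k = k} {l} i+0≡ _ _ = record
  { a = k ; b = l ; m = 0 ; a+m≡k = +-identityʳ k ; b+m≡l = +-identityʳ l ; m≤t = z≤n ; agree = agree-[]
  ; left-end = inj₁ (≤-reflexive (trans (sym i+0≡) (+-identityʳ i)) , inj₁ refl) }
desubstitute (suc t) {i} {j} {k} {l} i+t≡ j+t≡ ag
  with desubstitute t (trans (sym (+-suc i t)) i+t≡) (trans (sym (+-suc j t)) j+t≡) (agree-tail ag)
... | record { a = a ; b = b ; m = m ; a+m≡k = a+m≡k ; b+m≡l = b+m≡l ; m≤t = m≤t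
             ; agree = ag′ ; left-end = left-end } =
  case left-end of λ where
    (inj₂ split) → ⊥-elim (split-unextendable split (start-b≡ 1 (Split.start-a≡ split)) (agree-head ag))
    (inj₁ (start-a≤1+i , anchored)) → case m≤n⇒m<n∨m≡n start-a≤1+i of λ where
      (inj₁ (s≤s start-a≤i)) → record
        { a = a ; b = b ; m = m ; a+m≡k = a+m≡k ; b+m≡l = b+m≡l ; m≤t = m≤n⇒m≤1+n m≤t ; agree = ag′
        ; left-end = inj₁ (start-a≤i , map₂ (<-trans (n<1+n i)) anchored) }
      (inj₂ start-a≡) → desubstitute-at-cut a b m a+m≡k b+m≡l m≤t ag′ start-a≡ (start-b≡ 0 start-a≡) (agree-head ag)
  where
    W = imageLength a m
    i-end : suc i + t ≡ start a + W
    i-end = trans (trans (sym (+-suc i t)) i+t≡) (trans (cong start (sym a+m≡k)) (start-+ a m))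
    j-end : suc j + t ≡ start b + W
    j-end = trans (trans (sym (+-suc j t)) j+t≡)
      (trans (cong start (sym b+m≡l)) (trans (start-+ b m) (cong (start b +_) (sym (imageLength-cong m ag′)))))
    start-b≡ : ∀ d → start a ≡ d + suc i → start b ≡ d + suc j
    start-b≡ d = aligned d i-end j-end

split-first≢1 : ∀ {i a b m} → Split i a b → Agree a b m → 0 < m → p a ≢ L1
split-first≢1 {m = suc _} (mkSplit _ α β refl refl p-α≢p-β p-α≢2 p-β≢2) ag _ p-a≡1
  with one-of-them-is-1 p-α≢p-β p-α≢2 p-β≢2
... | inj₁ p-α≡1 = p-no-square α (trans p-α≡1 (sym p-a≡1))
... | inj₂ p-β≡1 = p-no-square β (trans p-β≡1 (trans (sym p-a≡1) (agree-head ag)))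

empty-preimage-short : ∀ {i a b t} → Anchored i a 0 ⊎ Split i a b → i + t ≡ start a → t ≤ 1
empty-preimage-short {i} {t = t} (inj₁ (start-a≤i , _)) i+t≡ =
  m≤n⇒m≤1+n (+-cancelˡ-≤ i t 0 (subst (_≤ i + 0) (sym i+t≡) (≤-trans start-a≤i (≤-reflexive (sym (+-identityʳ i))))))
empty-preimage-short {i} {t = t} (inj₂ split) i+t≡ =
  ≤-reflexive (+-cancelˡ-≡ i t 1 (trans i+t≡ (trans (Split.start-a≡ split) (+-comm 1 i))))

preimage-length≤ : ∀ {i a b n q} → Anchored i a (suc q) ⊎ Split i a b →
  i + suc (suc n) ≡ start (a + suc q) → p (a + q) ≢ L2 → suc q ≤ suc n
preimage-length≤ {i} {a} {n = n} {q} (inj₂ split) end p≢2 =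
  m≤n⇒m≤1+n (≤-pred (≤-trans (2+m≤imageLength a q p≢2) (≤-reflexive image≡)))
  where
    image≡ : imageLength a (suc q) ≡ suc n
    image≡ = suc-injective (+-cancelˡ-≡ i _ _ (begin
      i + suc (imageLength a (suc q)) ≡⟨ +-suc i _ ⟩
      suc i + imageLength a (suc q)   ≡⟨ cong (_+ imageLength a (suc q)) (sym (Split.start-a≡ split)) ⟩
      start a + imageLength a (suc q) ≡⟨ sym (start-+ a (suc q)) ⟩
      start (a + suc q)               ≡⟨ sym end ⟩
      i + suc (suc n)                 ∎))
      where open ≡-Reasoning
preimage-length≤ (inj₁ (_ , inj₁ ())) _ _
preimage-length≤ {q = zero} (inj₁ (_ , inj₂ _)) _ _ = s≤s z≤n
preimage-length≤ {i} {a} {n = n} {suc q} (inj₁ (_ , inj₂ i<start)) end p≢2 =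
  ≤-trans (2+m≤imageLength (suc a) q (subst (λ x → p x ≢ L2) (+-suc a q) p≢2)) (≤-pred tail≤)
  where
    tail≤ : suc (imageLength (suc a) (suc q)) ≤ suc (suc n)
    tail≤ = +-cancelˡ-≤ i _ _ (begin
      i + suc (imageLength (suc a) (suc q))     ≡⟨ +-suc i _ ⟩
      suc i + imageLength (suc a) (suc q)       ≤⟨ +-monoˡ-≤ _ i<start ⟩
      start (suc a) + imageLength (suc a) (suc q) ≡⟨ sym (start-+ (suc a) (suc q)) ⟩
      start (suc a + suc q)                     ≡⟨ cong start (sym (+-suc a (suc q))) ⟩
      start (a + suc (suc q))                   ≡⟨ sym end ⟩
      i + suc (suc n)                           ∎)
      where open ≤-Reasoning hiding (start)

last-letter-branches : ∀ {a b q k l} → Agree a b (suc q) → a + suc q ≡ k → b + suc q ≡ l →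
  p (a + q) ⟶ p k × p (a + q) ⟶ p l
last-letter-branches {a} {b} {q} ag a+m≡k b+m≡l =
  subst (p (a + q) ⟶_) (cong p a+m≡k) (p-⟶-at a q refl) ,
  subst (p (a + q) ⟶_) (cong p b+m≡l) (p-⟶-at b q (sym (agree-last ag)))

desubstitution-last : ∀ {τ t i j k l} (D : Desubstitution t i j k l) → (∀ {x} → x ⟶ p k → x ⟶ p l → x ≡ τ) →
  ∀ {q} → Desubstitution.m D ≡ suc q → p (Desubstitution.a D + q) ≡ τ
desubstitution-last D branch refl = branch (proj₁ branches) (proj₂ branches)
  where
    open Desubstitution D
    branches = last-letter-branches agree a+m≡k b+m≡l

desubstitution-nonempty : ∀ {t i j k l} (D : Desubstitution (suc (suc t)) i j k l) →
  i + suc (suc t) ≡ start k → 0 < Desubstitution.m D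
desubstitution-nonempty record { m = suc _ } _ = s≤s z≤n
desubstitution-nonempty {t} record { a = a ; m = zero ; a+m≡k = a+0≡k ; left-end = left-end } i+t≡ =
  ⊥-elim (n≮0 (≤-pred (empty-preimage-short left-end (trans i+t≡ (cong start (trans (sym a+0≡k) (+-identityʳ a)))))))

desubstitution-shorter : ∀ {n i j k l} (D : Desubstitution (suc (suc n)) i j k l) → i + suc (suc n) ≡ start k →
  (∀ {q} → Desubstitution.m D ≡ suc q → p (Desubstitution.a D + q) ≢ L2) → Desubstitution.m D ≤ suc n
desubstitution-shorter record { m = zero } _ _ = z≤n
desubstitution-shorter record { a = a ; m = suc q ; a+m≡k = a+m≡k ; left-end = left-end } i+t≡ last≢2 =
  preimage-length≤ left-end (trans i+t≡ (cong start (sym a+m≡k))) (last≢2 refl)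

-- Uniqueness of right special factors

RightSpecial : ℕ → ℕ → ℕ → Set
RightSpecial n i j = Agree i j n × p (i + n) ≢ p (j + n)

rightSpecial-drop : ∀ {i j} d n → RightSpecial (d + n) i j → RightSpecial n (i + d) (j + d)
rightSpecial-drop {i} {j} d n (ag , ext≢) = agree-drop d n ag ,
  λ ext≡ → ext≢ (trans (cong p (sym (+-assoc i d n))) (trans ext≡ (cong p (+-assoc j d n))))

rightSpecial-last≢2 : ∀ {n i j} → RightSpecial (suc n) i j → p (i + n) ≢ L2
rightSpecial-last≢2 {n} {i} {j} (ag , ext≢) p≡2 = ext≢ (begin
  p (i + suc n)   ≡⟨ cong p (+-suc i n) ⟩
  p (suc (i + n)) ≡⟨ p-after-2 (i + n) p≡2 ⟩
  L1              ≡⟨ sym (p-after-2 (j + n) (trans (sym (agree-last ag)) p≡2)) ⟩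
  p (suc (j + n)) ≡⟨ cong p (sym (+-suc j n)) ⟩
  p (j + suc n)   ∎)
  where open ≡-Reasoning

UniqueRightSpecial : ℕ → Set
UniqueRightSpecial n = ∀ {i j i′ j′} → RightSpecial (suc n) i j → RightSpecial (suc n) i′ j′ →
  p (i + n) ≡ p (i′ + n) → Agree i i′ (suc n)

-- p[i, i + t) is a suffix of the image of the right special window p[a, a + m) with last letter τ,
-- up to its first letter in the Split case. The last two fields matter only when m = 0.
record Preimage (τ : Letter) (t i N : ℕ) : Set where
  field
    a b m : ℕ
    rightSpecial : RightSpecial m a b
    end : i + t ≡ start (a + m)
    left-end : Anchored i a m ⊎ Split i a b
    last≡τ : ∀ {q} → m ≡ suc q → p (a + q) ≡ τ
    m≤N : m ≤ N
    next≢1 : τ ≡ L1 → p (a + m) ≢ L1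
    nonempty : τ ≢ L1 → 0 < m

agree-rightSpecial : ∀ {N a b a′ b′} → (∀ {q} → q < N → UniqueRightSpecial q) →
  ∀ m → m ≤ N → RightSpecial m a b → RightSpecial m a′ b′ →
  (∀ {q} → m ≡ suc q → p (a + q) ≡ p (a′ + q)) → Agree a a′ m
agree-rightSpecial _ zero _ _ _ _ = agree-[]
agree-rightSpecial unique-below (suc q) 1+q≤N rs rs′ last≡ = unique-below 1+q≤N rs rs′ (last≡ refl)

agree-split : ∀ {i i′ t a b a′ w} → Split i a b → i + t ≡ start a + w → i′ + t ≡ start a′ + w →
  Agree (start a) (start a′) w → p a′ ≢ L1 → Agree i i′ t
agree-split {i} {i′} {t} {a} {a′ = a′} {w} split i-end i′-end images p-a′≢1 =
  subst (Agree i i′) (sym t≡1+w)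
    (agree-∷ (trans p-i≡1 (sym p-i′≡1)) (subst₂ (λ x y → Agree x y w) start-a≡ start-a′≡ images))
  where
    open Split split
    t≡1+w : t ≡ suc w
    t≡1+w = +-cancelˡ-≡ i t (suc w) (trans i-end (trans (cong (_+ w) start-a≡) (sym (+-suc i w))))
    start-a′≡ : start a′ ≡ suc i′
    start-a′≡ = aligned {x = start a} {y = start a′} {w = w} 1 i-end i′-end start-a≡
    p-i≡1 : p i ≡ L1
    p-i≡1 = trans (p-last α (subst (λ x → start x ≡ suc i) a≡ start-a≡)) (lastLetter≢2 p-α≢2)
    p-i′≡1 : p i′ ≡ L1
    p-i′≡1 = p-before-start {a′} start-a′≡ p-a′≢1

agree-from-preimages-≤ : ∀ {τ t N i i′} → (∀ {q} → q < N → UniqueRightSpecial q) →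
  (s : Preimage τ t i N) (s′ : Preimage τ t i′ N) → Preimage.m s ≤ Preimage.m s′ → Agree i i′ t
agree-from-preimages-≤ {τ} {t} {N} {i} {i′} unique-below s s′ m≤m′ = case S.left-end of λ where
    (inj₁ (start-a≤i , _)) → agree-inner start-a≤i i-end i′-end images
    (inj₂ split) → agree-split {a′ = a″} split i-end i′-end images (p-a″≢1 split)
  where
    module S = Preimage s
    module S′ = Preimage s′
    d = proj₁ (m≤n⇒∃[o]m+o≡n m≤m′)
    d+m≡m′ : d + S.m ≡ S′.m
    d+m≡m′ = trans (+-comm d S.m) (proj₂ (m≤n⇒∃[o]m+o≡n m≤m′))
    a″ = S′.a + d
    -- The shorter preimage agrees with the suffix of the same length of the longer one.
    preimages : Agree S.a a″ S.m
    preimages = agree-rightSpecial unique-below S.m S.m≤N S.rightSpecial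
      (rightSpecial-drop d S.m (subst (λ n → RightSpecial n S′.a S′.b) (sym d+m≡m′) S′.rightSpecial))
      (λ {q} m≡ → trans (S.last≡τ m≡) (sym (trans (cong p (+-assoc S′.a d q))
                     (S′.last≡τ (trans (sym d+m≡m′) (trans (cong (d +_) m≡) (+-suc d q)))))))
    W = imageLength S.a S.m
    images : Agree (start S.a) (start a″) W
    images = agree-image S.m preimages
    i-end : i + t ≡ start S.a + W
    i-end = trans S.end (start-+ S.a S.m)
    i′-end : i′ + t ≡ start a″ + W
    i′-end = trans S′.end (trans (cong start (trans (cong (S′.a +_) (sym d+m≡m′)) (sym (+-assoc S′.a d S.m))))
      (trans (start-+ a″ S.m) (cong (start a″ +_) (sym (imageLength-cong S.m preimages)))))
    -- In the Split case position i′ must also be the last letter 1 of a two-letter block.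
    p-a″≢1 : Split i S.a S.b → p a″ ≢ L1
    p-a″≢1 split with S.m ≟ 0 | τ ≟ᶠ L1
    ... | no m≢0 | _ = subst (_≢ L1) p-a≡p-a″ (split-first≢1 split (proj₁ S.rightSpecial) (n≢0⇒n>0 m≢0))
      where
        p-a≡p-a″ : p S.a ≡ p a″
        p-a≡p-a″ = trans (cong p (sym (+-identityʳ S.a)))
          (trans (at preimages 0 (n≢0⇒n>0 m≢0)) (cong p (+-identityʳ a″)))
    ... | yes m≡0 | yes τ≡1 = subst (λ x → p (S′.a + x) ≢ L1)
      (sym (trans (sym (+-identityʳ d)) (trans (cong (d +_) (sym m≡0)) d+m≡m′))) (S′.next≢1 τ≡1)
    ... | yes m≡0 | no τ≢1 = ⊥-elim (<-irrefl (sym m≡0) (S.nonempty τ≢1))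

agree-from-preimages : ∀ {τ t N i i′} → (∀ {q} → q < N → UniqueRightSpecial q) →
  Preimage τ t i N → Preimage τ t i′ N → Agree i i′ t
agree-from-preimages unique-below s s′ with ≤-total (Preimage.m s) (Preimage.m s′)
... | inj₁ m≤m′ = agree-from-preimages-≤ unique-below s s′ m≤m′
... | inj₂ m′≤m = agree-sym (agree-from-preimages-≤ unique-below s′ s m′≤m)

preimage : ∀ {τ t i j k l N} (D : Desubstitution t i j k l) → i + t ≡ start k → p k ≢ p l →
  (∀ {q} → Desubstitution.m D ≡ suc q → p (Desubstitution.a D + q) ≡ τ) → Desubstitution.m D ≤ N →
  (τ ≡ L1 → p k ≢ L1) → (τ ≢ L1 → 0 < Desubstitution.m D) → Preimage τ t i N
preimage D i+t≡ p-k≢p-l last≡τ m≤N next≢1 nonempty = record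
  { a = a ; b = b ; m = m
  ; rightSpecial = agree , λ eq → p-k≢p-l (trans (cong p (sym a+m≡k)) (trans eq (cong p b+m≡l)))
  ; end = trans i+t≡ (cong start (sym a+m≡k))
  ; left-end = left-end
  ; last≡τ = last≡τ
  ; m≤N = m≤N
  ; next≢1 = λ τ≡1 → subst (_≢ L1) (cong p (sym a+m≡k)) (next≢1 τ≡1)
  ; nonempty = nonempty }
  where
    open Desubstitution D

-- A right special factor ending in 0: drop the 0, which starts a block, and desubstitute.
preimage-ending-in-0 : ∀ {N i j} → RightSpecial (suc N) i j → p (i + N) ≡ L0 → Preimage L1 N i N
preimage-ending-in-0 {N} {i} {j} (ag , ext≢) p≡0 =
  from-blocks (starts-block (i + N) (subst (_≢ L1) (sym p≡0) λ ()))
              (starts-block (j + N) (subst (_≢ L1) (sym p-j≡0) λ ()))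
  where
    p-j≡0 : p (j + N) ≡ L0
    p-j≡0 = trans (sym (agree-last ag)) p≡0
    from-blocks : (∃ λ k → i + N ≡ start k) → (∃ λ l → j + N ≡ start l) → Preimage L1 N i N
    from-blocks (k , i+N≡) (l , j+N≡) =
      preimage D i+N≡ p-k≢p-l (desubstitution-last D λ x⟶ x⟶′ → ⟶-branching-avoiding-1 x⟶ x⟶′ p-k≢p-l p-k≢1 p-l≢1)
        (Desubstitution.m≤t D) (λ _ → p-k≢1) (λ τ≢1 → ⊥-elim (τ≢1 refl))
      where
        D : Desubstitution N i j k l
        D = desubstitute N i+N≡ j+N≡ (agree-≤ (n≤1+n N) ag)
        p-start-k≡0 : p (start k) ≡ L0
        p-start-k≡0 = trans (cong p (sym i+N≡)) p≡0
        p-start-l≡0 : p (start l) ≡ L0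
        p-start-l≡0 = trans (cong p (sym j+N≡)) p-j≡0
        p-k≢1 : p k ≢ L1
        p-k≢1 = p-start≡0⇒p≢1 k p-start-k≡0
        p-l≢1 : p l ≢ L1
        p-l≢1 = p-start≡0⇒p≢1 l p-start-l≡0
        p-k≢p-l : p k ≢ p l
        p-k≢p-l p-k≡p-l = ext≢ (begin
          p (i + suc N)       ≡⟨ cong p (trans (+-suc i N) (cong suc i+N≡)) ⟩
          p (suc (start k))   ≡⟨ Equivalence.to (after-0-block-start {k} {l} p-start-k≡0 p-start-l≡0) p-k≡p-l ⟩
          p (suc (start l))   ≡⟨ cong p (sym (trans (+-suc j N) (cong suc j+N≡))) ⟩
          p (j + suc N)       ∎)
          where open ≡-Reasoning

-- A right special factor ending in 1: its extensions start blocks, so desubstitute it whole.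
preimage-ending-in-1 : ∀ {n i j} → RightSpecial (suc (suc n)) i j → p (i + suc n) ≡ L1 →
  Preimage L0 (suc (suc n)) i (suc n)
preimage-ending-in-1 {n} {i} {j} (ag , ext≢) p≡1 =
  from-blocks (starts-block (i + suc N) (after≢1 i p≡1)) (starts-block (j + suc N) (after≢1 j p-j≡1))
  where
    N = suc n
    p-j≡1 : p (j + N) ≡ L1
    p-j≡1 = trans (sym (agree-last ag)) p≡1
    after≢1 : ∀ x → p (x + N) ≡ L1 → p (x + suc N) ≢ L1
    after≢1 x p≡1 = ⟶-irrefl (p-⟶-at x N p≡1) ∘ sym
    from-blocks : (∃ λ k → i + suc N ≡ start k) → (∃ λ l → j + suc N ≡ start l) → Preimage L0 (suc N) i N
    from-blocks (k , i+N+1≡) (l , j+N+1≡) =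
      preimage D i+N+1≡ (first≢ ∘ cong firstLetter) last≡0 m≤N (λ ()) (λ _ → desubstitution-nonempty D i+N+1≡)
      where
        D : Desubstitution (suc N) i j k l
        D = desubstitute (suc N) i+N+1≡ j+N+1≡ ag
        open Desubstitution D
        first≢ : firstLetter (p k) ≢ firstLetter (p l)
        first≢ eq = ext≢ (trans (trans (cong p i+N+1≡) (p-start k))
                                (trans eq (sym (trans (cong p j+N+1≡) (p-start l)))))
        last≡0 : ∀ {q} → m ≡ suc q → p (a + q) ≡ L0
        last≡0 = desubstitution-last D λ x⟶ x⟶′ → ⟶-branching-with-first-letters x⟶ x⟶′ first≢
        m≤N : m ≤ N
        m≤N = desubstitution-shorter D i+N+1≡ λ m≡ → subst (_≢ L2) (sym (last≡0 m≡)) λ ()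

uniqueRightSpecial : ∀ n → UniqueRightSpecial n
uniqueRightSpecial = <-rec UniqueRightSpecial step
  where
    step : ∀ n → (∀ {q} → q < n → UniqueRightSpecial q) → UniqueRightSpecial n
    step zero _ _ _ last≡ = agree-∷ʳ agree-[] last≡
    step (suc n) below {i} {i′ = i′} rs rs′ last≡ = by-last-letter (p (i + suc n)) refl
      where
        by-last-letter : ∀ c → p (i + suc n) ≡ c → Agree i i′ (suc (suc n))
        by-last-letter L0 p≡0 = agree-∷ʳ (agree-from-preimages below (preimage-ending-in-0 rs p≡0)
                                            (preimage-ending-in-0 rs′ (trans (sym last≡) p≡0))) last≡
        by-last-letter L1 p≡1 = agree-from-preimages below (preimage-ending-in-1 rs p≡1)
                                                      (preimage-ending-in-1 rs′ (trans (sym last≡) p≡1))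
        by-last-letter L2 p≡2 = ⊥-elim (rightSpecial-last≢2 rs p≡2)

-- Existence of right special factors

RightSpecialEndingIn : Letter → ℕ → Set
RightSpecialEndingIn τ n = ∃ λ i → ∃ λ j → RightSpecial (suc n) i j × p (i + n) ≡ τ

rightSpecialEndingIn-≤ : ∀ {τ m n} → m ≤ n → RightSpecialEndingIn τ n → RightSpecialEndingIn τ m
rightSpecialEndingIn-≤ {m = m} m≤n (i , j , rs , last≡) with m≤n⇒∃[o]m+o≡n m≤n
... | d , refl = i + d , j + d ,
  rightSpecial-drop d (suc m)
    (subst (λ n → RightSpecial n i j) (trans (cong suc (+-comm m d)) (sym (+-suc d m))) rs) ,
  trans (cong p (trans (+-assoc i d m) (cong (i +_) (+-comm d m)))) last≡

rightSpecialEndingIn-from : ∀ {τ n w x y} → suc n ≤ w → RightSpecial w x y →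
  (∀ {w′} → w ≡ suc w′ → p (x + w′) ≡ τ) → RightSpecialEndingIn τ n
rightSpecialEndingIn-from {w = suc w′} {x} {y} 1+n≤w rs last≡ =
  rightSpecialEndingIn-≤ (≤-pred 1+n≤w) (x , y , rs , last≡ refl)

-- The image of a right special factor ending in 0 ends in h(0) = 01 and is right special.
rightSpecial-1-from-0 : ∀ {n} → RightSpecialEndingIn L0 n → RightSpecialEndingIn L1 n
rightSpecial-1-from-0 {n} (a , b , (ag , ext≢) , last≡0) =
  rightSpecialEndingIn-from (m≤imageLength a (suc n)) (agree-image (suc n) ag , image-ext≢) last≡1
  where
    W = imageLength a (suc n)
    ends = image-ends (suc n) ag
    0⟶x : L0 ⟶ p (a + suc n)
    0⟶x = p-⟶-at a n last≡0
    0⟶y : L0 ⟶ p (b + suc n)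
    0⟶y = p-⟶-at b n (trans (sym (agree-last ag)) last≡0)
    image-ext≢ : p (start a + W) ≢ p (start b + W)
    image-ext≢ eq = ext≢ (firstLetter-injective-after-0 0⟶x 0⟶y (begin
      firstLetter (p (a + suc n)) ≡⟨ sym (p-start (a + suc n)) ⟩
      p (start (a + suc n))       ≡⟨ cong p (proj₁ ends) ⟩
      p (start a + W)             ≡⟨ eq ⟩
      p (start b + W)             ≡⟨ cong p (sym (proj₂ ends)) ⟩
      p (start (b + suc n))       ≡⟨ p-start (b + suc n) ⟩
      firstLetter (p (b + suc n)) ∎))
      where open ≡-Reasoning
    last≡1 : ∀ {w′} → W ≡ suc w′ → p (start a + w′) ≡ L1
    last≡1 {w′} W≡ = trans (p-last (a + n) start≡) (cong lastLetter last≡0)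
      where
        start≡ : start (suc (a + n)) ≡ suc (start a + w′)
        start≡ = trans (cong start (sym (+-suc a n)))
          (trans (proj₁ ends) (trans (cong (start a +_) W≡) (+-suc (start a) w′)))

-- The image of a right special factor ending in 1, followed by the common letter 0, is right special.
rightSpecial-0-from-1 : ∀ {n} → RightSpecialEndingIn L1 n → RightSpecialEndingIn L0 (suc n)
rightSpecial-0-from-1 {n} (a , b , (ag , ext≢) , last≡1) =
  rightSpecialEndingIn-≤ (m≤imageLength a (suc n))
    (start a , start b ,
     (agree-∷ʳ (agree-image (suc n) ag) (trans p-a-end≡0 (sym p-b-end≡0)) , image-ext≢) , p-a-end≡0)
  where
    W = imageLength a (suc n)
    ends = image-ends (suc n) ag
    1⟶x : L1 ⟶ p (a + suc n)
    1⟶x = p-⟶-at a n last≡1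
    1⟶y : L1 ⟶ p (b + suc n)
    1⟶y = p-⟶-at b n (trans (sym (agree-last ag)) last≡1)
    p-start-k≡0 : p (start (a + suc n)) ≡ L0
    p-start-k≡0 = trans (p-start (a + suc n)) (firstLetter-after-1 1⟶x)
    p-start-l≡0 : p (start (b + suc n)) ≡ L0
    p-start-l≡0 = trans (p-start (b + suc n)) (firstLetter-after-1 1⟶y)
    p-a-end≡0 : p (start a + W) ≡ L0
    p-a-end≡0 = trans (cong p (sym (proj₁ ends))) p-start-k≡0
    p-b-end≡0 : p (start b + W) ≡ L0
    p-b-end≡0 = trans (cong p (sym (proj₂ ends))) p-start-l≡0
    image-ext≢ : p (start a + suc W) ≢ p (start b + suc W)
    image-ext≢ eq = ext≢ (Equivalence.from (after-0-block-start {a + suc n} {b + suc n} p-start-k≡0 p-start-l≡0)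
      (trans (cong p (trans (cong suc (proj₁ ends)) (sym (+-suc (start a) W))))
        (trans eq (cong p (trans (+-suc (start b) W) (cong suc (sym (proj₂ ends))))))))

rightSpecialEndingIn-0 : ∀ n → RightSpecialEndingIn L0 n
rightSpecialEndingIn-0 zero = 0 , 4 , (agree-∷ʳ agree-[] refl , λ ()) , refl
rightSpecialEndingIn-0 (suc n) = rightSpecial-0-from-1 (rightSpecial-1-from-0 (rightSpecialEndingIn-0 n))

rightSpecialEndingIn-1 : ∀ n → RightSpecialEndingIn L1 n
rightSpecialEndingIn-1 n = rightSpecial-1-from-0 (rightSpecialEndingIn-0 n)

-- Counting factors

record Representatives (n : ℕ) : Set where
  field
    positions : List ℕ
    distinct : AllPairs (λ x y → ¬ Agree x y n) positions
    complete : ∀ k → ∃ λ r → r ∈ positions × Agree r k n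
    count : length positions ≡ 2 * n + 1

agree-∈-unique : ∀ {n I x y} → AllPairs (λ x y → ¬ Agree x y n) I → x ∈ I → y ∈ I → Agree x y n → x ≡ y
agree-∈-unique (_ ∷ _) (here refl) (here refl) _ = refl
agree-∈-unique (x≁ ∷ _) (here refl) (there y∈) ag = ⊥-elim (All.lookup x≁ y∈ ag)
agree-∈-unique (y≁ ∷ _) (there x∈) (here refl) ag = ⊥-elim (All.lookup y≁ x∈ (agree-sym ag))
agree-∈-unique (_ ∷ distinct) (there x∈) (there y∈) ag = agree-∈-unique distinct x∈ y∈ ag

-- r ∈ I represents the right special factor of length N + 1 ending in τ, and e is an occurrence
-- of its second extension.
record Branch (N : ℕ) (I : List ℕ) (τ : Letter) : Set where
  field
    r e : ℕ
    r∈I : r ∈ I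
    r-last : p (r + N) ≡ τ
    r-unique : ∀ {x y} → RightSpecial (suc N) x y → p (x + N) ≡ τ → Agree x r (suc N)
    e-agree : Agree e r (suc N)
    e-ext≢ : p (e + suc N) ≢ p (r + suc N)

branch : ∀ {N τ} (R : Representatives (suc N)) → RightSpecialEndingIn τ N → Branch N (Representatives.positions R) τ
branch {N} R (i , j , rs@(ag , ext≢) , last≡) with Representatives.complete R i
... | r , r∈I , r≈i = record
  { r = r ; e = proj₁ other ; r∈I = r∈I
  ; r-last = trans (agree-last r≈i) last≡
  ; r-unique = λ rs′ last≡′ → agree-trans (uniqueRightSpecial N rs′ rs (trans last≡′ (sym last≡))) (agree-sym r≈i)
  ; e-agree = proj₁ (proj₂ other) ; e-ext≢ = proj₂ (proj₂ other) }
  where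
    other : ∃ λ e → Agree e r (suc N) × p (e + suc N) ≢ p (r + suc N)
    other with p (r + suc N) ≟ᶠ p (i + suc N)
    ... | yes r-ext≡i-ext =
      j , agree-trans (agree-sym ag) (agree-sym r≈i) , λ eq → ext≢ (trans (sym r-ext≡i-ext) (sym eq))
    ... | no r-ext≢i-ext = i , agree-sym r≈i , r-ext≢i-ext ∘ sym

branch-fresh : ∀ {N I τ} → AllPairs (λ x y → ¬ Agree x y (suc N)) I → (B : Branch N I τ) →
  All (λ y → ¬ Agree (Branch.e B) y (suc (suc N))) I
branch-fresh {N} distinct B = All.tabulate λ {x} x∈I ag →
  e-ext≢ (trans (agree-last ag) (cong (λ z → p (z + suc N))
    (agree-∈-unique distinct x∈I r∈I (agree-trans (agree-sym (agree-≤ (n≤1+n _) ag)) e-agree))))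
  where open Branch B

branch-covers : ∀ {N I τ} → AllPairs (λ x y → ¬ Agree x y (suc N)) I → (B : Branch N I τ) →
  ∀ {x k} → x ∈ I → Agree x k (suc N) → p (x + suc N) ≢ p (k + suc N) → p (x + N) ≡ τ →
  Agree (Branch.e B) k (suc (suc N))
branch-covers {N} distinct B {x} {k} x∈I x≈k ext≢ last≡ with
  agree-∈-unique distinct x∈I r∈I (r-unique (x≈k , ext≢) last≡)
  where open Branch B
... | refl = agree-∷ʳ (agree-trans e-agree x≈k) (sym (⟶-at-most-two
  (p-⟶-at k N (trans (sym (agree-last x≈k)) last≡)) (p-⟶-at e N (trans (agree-last e-agree) r-last))
  (p-⟶-at r N r-last)
  (ext≢ ∘ sym) e-ext≢))
  where open Branch B

representatives-extend : ∀ {N} (R : Representatives (suc N)) →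
  Branch N (Representatives.positions R) L0 → Branch N (Representatives.positions R) L1 →
  Representatives (suc (suc N))
representatives-extend {N} R B₀ B₁ = record
  { positions = B₀.e ∷ B₁.e ∷ R.positions
  ; distinct = (e₀≁e₁ ∷ branch-fresh R.distinct B₀) ∷ branch-fresh R.distinct B₁
             ∷ AllPairs.map (λ x≁y ag → x≁y (agree-≤ (n≤1+n _) ag)) R.distinct
  ; complete = complete
  ; count = trans (cong (λ c → suc (suc c)) R.count) (cong (_+ 1) (sym (*-suc 2 (suc N)))) }
  where
    module R = Representatives R
    module B₀ = Branch B₀
    module B₁ = Branch B₁
    e₀≁e₁ : ¬ Agree B₀.e B₁.e (suc (suc N))
    e₀≁e₁ ag = case trans (sym (trans (agree-last B₀.e-agree) B₀.r-last))
                          (trans (at ag N (m<n⇒m<1+n (n<1+n N))) (trans (agree-last B₁.e-agree) B₁.r-last)) of λ ()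
    complete : ∀ k → ∃ λ r → r ∈ B₀.e ∷ B₁.e ∷ R.positions × Agree r k (suc (suc N))
    complete k with R.complete k
    ... | r , r∈I , r≈k with p (r + suc N) ≟ᶠ p (k + suc N)
    ...   | yes ext≡ = r , there (there r∈I) , agree-∷ʳ r≈k ext≡
    ...   | no ext≢ = by-last-letter (p (r + N)) refl
      where
        by-last-letter : ∀ τ → p (r + N) ≡ τ → ∃ λ r → r ∈ B₀.e ∷ B₁.e ∷ R.positions × Agree r k (suc (suc N))
        by-last-letter L0 last≡ = B₀.e , here refl , branch-covers R.distinct B₀ r∈I r≈k ext≢ last≡
        by-last-letter L1 last≡ = B₁.e , there (here refl) , branch-covers R.distinct B₁ r∈I r≈k ext≢ last≡
        by-last-letter L2 last≡ = ⊥-elim (rightSpecial-last≢2 (r≈k , ext≢) last≡)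

representatives-suc : ∀ N → Representatives (suc N) → Representatives (suc (suc N))
representatives-suc N R =
  representatives-extend R (branch R (rightSpecialEndingIn-0 N)) (branch R (rightSpecialEndingIn-1 N))

representatives : ∀ n → Representatives n
representatives zero = record
  { positions = 0 ∷ [] ; distinct = [] ∷ [] ; complete = λ _ → 0 , here refl , agree-[] ; count = refl }
representatives (suc zero) = record
  { positions = 0 ∷ 1 ∷ 2 ∷ []
  ; distinct = ((λ ag → case agree-head ag of λ ()) ∷ (λ ag → case agree-head ag of λ ()) ∷ [])
             ∷ ((λ ag → case agree-head ag of λ ()) ∷ []) ∷ [] ∷ []
  ; complete = λ k → by-letter k (p k) refl
  ; count = refl }
  where
    by-letter : ∀ k c → p k ≡ c → ∃ λ r → r ∈ 0 ∷ 1 ∷ 2 ∷ [] × Agree r k 1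
    by-letter k L0 p≡ = 0 , here refl , agree-∷ (sym p≡) agree-[]
    by-letter k L1 p≡ = 1 , there (here refl) , agree-∷ (sym p≡) agree-[]
    by-letter k L2 p≡ = 2 , there (there (here refl)) , agree-∷ (sym p≡) agree-[]
representatives (suc (suc n)) = representatives-suc n (representatives (suc n))

window : (n : ℕ) → ℕ → Vec Letter n
window n i = tabulate λ j → p (i + toℕ j)

window-isFactor : ∀ n i → IsFactor (window n i)
window-isFactor n i = i , lookup∘tabulate _

isFactor⇒window : ∀ {n} (w : Vec Letter n) → IsFactor w → ∃ λ i → w ≡ window n i
isFactor⇒window w (i , w≡) = i , trans (sym (tabulate∘lookup w)) (tabulate-cong w≡)

window-cong : ∀ {n x y} → Agree x y n → window n x ≡ window n y
window-cong ag = tabulate-cong λ j → at ag (toℕ j) (toℕ<n j)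

window-injective : ∀ {n x y} → window n x ≡ window n y → Agree x y n
window-injective {n} {x} {y} eq = mkAgree λ t t<n →
  trans (sym (lookup-window x t<n)) (trans (cong (λ w → lookup w (fromℕ< t<n)) eq) (lookup-window y t<n))
  where
    lookup-window : ∀ z {t} (t<n : t < n) → lookup (window n z) (fromℕ< t<n) ≡ p (z + t)
    lookup-window z t<n = trans (lookup∘tabulate _ (fromℕ< t<n)) (cong (λ u → p (z + u)) (toℕ-fromℕ< t<n))

window-∈⇔isFactor : ∀ {n} (R : Representatives n) (w : Vec Letter n) →
  w ∈ map (window n) (Representatives.positions R) ⇔ IsFactor w
window-∈⇔isFactor {n} R w = mk⇔ listed⇒factor factor⇒listed
  where
    open Representatives R
    listed⇒factor : w ∈ map (window n) positions → IsFactor w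
    listed⇒factor w∈ with ∈-map⁻ (window n) w∈
    ... | i , _ , refl = window-isFactor n i
    factor⇒listed : IsFactor w → w ∈ map (window n) positions
    factor⇒listed factor with isFactor⇒window w factor
    ... | i , refl with complete i
    ...   | r , r∈ , r≈i = subst (_∈ map (window n) positions) (window-cong r≈i) (∈-map⁺ (window n) r∈)

theorem1 : (n : ℕ) → ComplexityIs n (2 * n + 1)
theorem1 n =
  map (window n) positions ,
  AllPairs.map⁺ (AllPairs.map (λ x≁y → x≁y ∘ window-injective) distinct) ,
  trans (length-map (window n) positions) count ,
  window-∈⇔isFactor R
  where
    R = representatives n
    open Representatives R
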